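{- Let $H$ be an $(\alpha,\beta)$-colorable hypergraph, let $q\geq \alpha+\beta+1$ and let $\chi,\tau$ be two good greedy colorings of $H$. Then there exists a path from $\chi$ to $\tau$ in $\Gamma_q(H)$.
   Context: For a hypergraph $H=(V,E)$: the degree of a vertex is the number of edges containing it; a $\beta$-core is a maximal subhypergraph in which every vertex has degree at least $\beta$; for $U\subseteq V$, "$U$ has a $\beta$-core" means the subhypergraph induced by $U$ has a nonempty $\beta$-core. A set is independent if it contains no edge. A sequence $V_1,\dots,V_\alpha$ of (possibly empty) sets is a maximally independent sequence of length $\alpha$ if for each $j$, $V_j$ is a maximal independent set in the subhypergraph induced by $V\setminus\bigcup_{i<j}V_i$. $H$ is $(\alpha,\beta)$-colorable if there is no maximally independent sequence of length $\alpha$ such that $V\setminus\bigcup_{i\leq\alpha}V_i$ has a $\beta$-core. A proper $[q]$-coloring is a map $V\to[q]$ with no monochromatic edge; $\Gamma_q(H)$ is the graph on proper $[q]$-colorings with adjacency meaning differing on exactly one vertex. A good greedy coloring is a proper coloring with color classes $V_1,V_2,\dots,V_{\alpha+\beta}$ (where $V_i$ is the class of color $i$) such that (i) $V_1,\dots,V_\alpha$ is a maximally independent sequence of length $\alpha$ and (ii) $V\setminus\bigcup_{\ell\leq\alpha}V_\ell$ has no $\beta$-core. -}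

module Defs where

open import Data.Nat using (ℕ; _≤_; _<_)
open import Data.Fin using (Fin; toℕ)
open import Data.Fin.Subset using (Subset; _∈_; _∉_; _⊆_; _∪_; _─_; ⁅_⁆; Nonempty; ⊤)
open import Data.Fin.Subset.Properties using (_⊆?_; _∈?_)
open import Data.Vec using (Vec; []; _∷_; lookup; tabulate)
open import Data.List using (List; filter; length)
open import Data.List.Membership.Propositional using () renaming (_∈_ to _∈ₗ_)
open import Data.List.Relation.Unary.Unique.Propositional using (Unique)
open import Data.Product using (Σ; ∃; _×_; _,_)
open import Data.Empty using (⊥)
open import Relation.Nullary using (¬_)
open import Relation.Nullary.Decidable using (_×-dec_; ⌊_⌋)
open import Relation.Binary.PropositionalEquality using (_≡_; _≢_)
open import Data.Nat using (_≟_)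

record Hypergraph (n : ℕ) : Set where
  field
    edges  : List (Subset n)
    unique : Unique edges
open Hypergraph public

module _ {n : ℕ} (H : Hypergraph n) where

  degreeIn : Subset n → Fin n → ℕ
  degreeIn W v = length (filter (λ e → (e ⊆? W) ×-dec (v ∈? e)) (edges H))

  -- U has a (nonempty) β-core: the subhypergraph induced by U has a nonempty
  -- β-core, i.e. some nonempty W ⊆ U in which every vertex has degree ≥ β
  -- (the β-core is the union of all such W).
  HasCore : ℕ → Subset n → Set
  HasCore β U = ∃ λ W → W ⊆ U × Nonempty W × (∀ v → v ∈ W → β ≤ degreeIn W v)

  Independent : Subset n → Set
  Independent S = ∀ e → e ∈ₗ edges H → ¬ (e ⊆ S)

  MaxIndepIn : Subset n → Subset n → Set
  MaxIndepIn U S = S ⊆ U × Independent S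
                 × (∀ v → v ∈ U → v ∉ S → ¬ Independent (S ∪ ⁅ v ⁆))

  MaxIndepSeqFrom : ∀ {k} → Subset n → Vec (Subset n) k → Set
  MaxIndepSeqFrom U []       = Data.Unit.⊤ where import Data.Unit
  MaxIndepSeqFrom U (S ∷ Ss) = MaxIndepIn U S × MaxIndepSeqFrom (U ─ S) Ss

  remainder : ∀ {k} → Subset n → Vec (Subset n) k → Subset n
  remainder U []       = U
  remainder U (S ∷ Ss) = remainder (U ─ S) Ss

  MaxIndepSeq : ∀ {k} → Vec (Subset n) k → Set
  MaxIndepSeq Ss = MaxIndepSeqFrom ⊤ Ss

  Colorable : ℕ → ℕ → Set
  Colorable α β = (Ss : Vec (Subset n) α) → MaxIndepSeq Ss → ¬ HasCore β (remainder ⊤ Ss)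

  -- colorings with colours Fin q (colour i ∈ Fin q stands for colour i+1 of [q])
  Coloring : ℕ → Set
  Coloring q = Vec (Fin q) n

  Monochromatic : ∀ {q} → Coloring q → Subset n → Set
  Monochromatic χ e = ∀ u v → u ∈ e → v ∈ e → lookup χ u ≡ lookup χ v

  Proper : ∀ {q} → Coloring q → Set
  Proper χ = ∀ e → e ∈ₗ edges H → ¬ Monochromatic χ e

  Adjacent : ∀ {q} → Coloring q → Coloring q → Set
  Adjacent χ ψ = ∃ λ v → lookup χ v ≢ lookup ψ v
                       × (∀ u → u ≢ v → lookup χ u ≡ lookup ψ u)

  data Path {q : ℕ} : Coloring q → Coloring q → Set where
    stop : ∀ {χ} → Path χ χ
    step : ∀ {χ ψ τ} → Proper ψ → Adjacent χ ψ → Path ψ τ → Path χ τ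

  colorClass : ∀ {q} → Coloring q → ℕ → Subset n
  colorClass χ i = tabulate λ v → ⌊ toℕ (lookup χ v) ≟ i ⌋

  GoodGreedy : ∀ {q} → ℕ → ℕ → Coloring q → Set
  GoodGreedy {q} α β χ =
      Proper χ
    × (∀ v → toℕ (lookup χ v) < α Data.Nat.+ β)
    × MaxIndepSeq firstα
    × ¬ HasCore β (remainder ⊤ firstα)
    where
      firstα : Vec (Subset n) α
      firstα = tabulate λ i → colorClass χ (toℕ i)

-- Call a colouring layered over U from level a with k greedy layers if outside U it is
-- fixed with colours below a, and on U it uses colours a, ..., a + k + β whose top part spans no β-core.
-- By induction on k, any two such colourings with the same outside are connected. For k = 0, U has no
-- β-core, hence a vertex v of degree < β in U: connect the two colourings on U - v inductively and
-- follow each move, after first recolouring v to one of the β + 1 palette colours not blocked by its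
-- fewer than β edges or by the colour about to be used. For k > 0, make the class of colour a a maximal
-- independent set M of U (so U ─ M is layered from a + 1), walk to a fresh greedy colouring of U ─ M
-- avoiding a + 1, lift M to colour a + 1 and drop the other colouring's set M′ to colour a; both are now
-- layered over U ─ M′ with equal outside. The spare colour q ≥ α + β + 1 is the extra palette colour.

module Submission where

open import Defs
open import Data.Bool using (true; false; if_then_else_)
open import Data.Empty using (⊥-elim)
open import Data.Fin as Fin using (Fin; toℕ; fromℕ<)
open import Data.Fin.Properties using (any?; all?; ¬∀⟶∃¬; toℕ-fromℕ<; toℕ<n; toℕ-injective)
  renaming (_≟_ to _≟ᶠ_)
open import Data.Fin.Subset
  using (Subset; _∈_; _∉_; _⊆_; _∪_; _─_; _-_; ⁅_⁆; ∁; Nonempty; ⊤; ⊥; ∣_∣)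
open import Data.Fin.Subset.Properties
  using (_∈?_; _⊆?_; ⊆-refl; nonempty?; ∈⊤; ∉⊥; x∈⁅x⁆; x∈⁅y⁆⇒x≡y; x∈p∪q⁺; x∈p∪q⁻; p─q⊆p;
         x∈p∧x∉q⇒x∈p─q; x∈p∧x≢y⇒x∈p-y; x∈p⇒∣p-x∣<∣p∣; x∈∁p⇒x∉p; x∉p⇒x∈∁p)
open import Data.List using (List; []; _∷_; map; filter; length; allFin)
open import Data.List.Properties using (length-map; filter-notAll)
open import Data.List.Membership.Propositional using () renaming (_∈_ to _∈ₗ_; _∉_ to _∉ₗ_)
open import Data.List.Membership.Propositional.Properties using (∈-allFin; ∈-filter⁺; ∈-map⁺; ∈-map⁻)
open import Data.List.Relation.Unary.Any using (here; there)
import Data.List.Relation.Unary.Any as Any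
import Data.List.Relation.Unary.All as All
open import Data.Nat using (ℕ; zero; suc; _+_; _≤_; _<_; _≤?_; _<?_; _≟_; z≤n; s≤s; z<s)
open import Data.List.Membership.DecPropositional _≟_ using () renaming (_∈?_ to _∈ℕ?_)
open import Data.Nat.Induction using (<-wellFounded)
open import Data.Nat.Properties
import Data.Product as Product
open import Data.Product using (∃; _×_; _,_; proj₁; proj₂)
import Data.Sum as Sum
open import Data.Sum using (_⊎_; inj₁; inj₂; [_,_])
import Data.Vec as Vec
open import Data.Vec using (Vec; []; _∷_; lookup; tabulate; replicate; _[_]≔_)
open import Data.Vec.Properties
  using (lookup∘tabulate; []=⇒lookup; lookup⇒[]=; lookup∘update; lookup∘update′; lookup-replicate)
open import Data.Vec.Relation.Binary.Pointwise.Extensional using (ext; Pointwise-≡⇒≡)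
import Data.Vec.Relation.Unary.All as VAll
open import Data.Vec.Relation.Unary.All.Properties using (tabulate⁺)
open import Function using (_∘_; _on_)
open import Induction.WellFounded using (WellFounded; Acc; acc)
open import Relation.Binary.Construct.Closure.ReflexiveTransitive using (Star; ε; _◅_; _◅◅_; reverse)
import Relation.Binary.Construct.Closure.ReflexiveTransitive as Star
import Relation.Binary.Construct.On as On
open import Relation.Binary.PropositionalEquality
  using (_≡_; _≢_; ≢-sym; refl; sym; trans; cong; subst; subst₂)
open import Relation.Nullary using (¬_; Dec; yes; no; does; contradiction)
open import Relation.Nullary.Decidable
  using (_×-dec_; _→-dec_; ¬?; map′; dec-true; dec-false; decidable-stable; ⌊_⌋)
open import Relation.Unary using (Decidable)

InRange : ℕ → ℕ → ℕ → Set
InRange a w m = a ≤ m × m < a + w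

inRange-suc : ∀ {a w m} → InRange (suc a) w m → InRange a (suc w) m
inRange-suc {a} {w} {m} (a<m , m<1+a+w) = <⇒≤ a<m , subst (m <_) (sym (+-suc a w)) m<1+a+w

inRange-pred : ∀ {a w m} → InRange a (suc w) m → a ≢ m → InRange (suc a) w m
inRange-pred {a} {w} {m} (a≤m , m<a+1+w) a≢m = ≤∧≢⇒< a≤m a≢m , subst (m <_) (+-suc a w) m<a+1+w

fresh-in-range : ∀ w a (xs : List ℕ) → length xs < w → ∃ λ m → InRange a w m × m ∉ₗ xs
fresh-in-range (suc w) a xs len with a ∈ℕ? xs
... | no a∉xs = a , (≤-refl , m<m+n a z<s) , a∉xs
... | yes a∈xs with fresh-in-range w (suc a) (filter (λ y → ¬? (y ≟ a)) xs) shorter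
  where
    shorter : length (filter (λ y → ¬? (y ≟ a)) xs) < w
    shorter = <-≤-trans (filter-notAll (λ y → ¬? (y ≟ a)) xs (Any.map (λ a≡y y≢a → y≢a (sym a≡y)) a∈xs))
                (≤-pred len)
... | m , (a<m , m<1+a+w) , m∉ =
  m , (<⇒≤ a<m , subst (m <_) (sym (+-suc a w)) m<1+a+w) ,
  λ m∈xs → m∉ (∈-filter⁺ (λ y → ¬? (y ≟ a)) m∈xs (λ { refl → <-irrefl refl a<m }))

Agree : ∀ {n} {A : Set} → (Fin n → Set) → Vec A n → Vec A n → Set
Agree P xs ys = ∀ x → P x → lookup xs x ≡ lookup ys x

module _ {n : ℕ} {A : Set} where

  agree-everywhere⇒≡ : {xs ys : Vec A n} → (∀ x → lookup xs x ≡ lookup ys x) → xs ≡ ys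
  agree-everywhere⇒≡ eq = Pointwise-≡⇒≡ (ext eq)

  agree-update : ∀ {u v : Fin n} {y : A} {xs ys : Vec A n} →
                 Agree (_≢ u) xs ys → Agree (_≢ u) (xs [ v ]≔ y) (ys [ v ]≔ y)
  agree-update {u} {v} {y} {xs} {ys} xs≈ys x x≢u with x ≟ᶠ v
  ... | yes refl = trans (lookup∘update x xs y) (sym (lookup∘update x ys y))
  ... | no x≢v   = trans (lookup∘update′ x≢v xs y) (trans (xs≈ys x x≢u) (sym (lookup∘update′ x≢v ys y)))

  choose : {P : Fin n → Set} → Decidable P → Vec A n → Vec A n → Fin n → A
  choose P? xs ys x = if does (P? x) then lookup ys x else lookup xs x

  overwrite : {P : Fin n → Set} → Decidable P → Vec A n → Vec A n → Vec A n
  overwrite P? xs ys = tabulate (choose P? xs ys)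

  module _ {P : Fin n → Set} (P? : Decidable P) (xs ys : Vec A n) {x : Fin n} where

    lookup-overwrite⁺ : P x → lookup (overwrite P? xs ys) x ≡ lookup ys x
    lookup-overwrite⁺ px = trans (lookup∘tabulate (choose P? xs ys) x)
      (cong (λ b → if b then lookup ys x else lookup xs x) (dec-true (P? x) px))

    lookup-overwrite⁻ : ¬ P x → lookup (overwrite P? xs ys) x ≡ lookup xs x
    lookup-overwrite⁻ ¬px = trans (lookup∘tabulate (choose P? xs ys) x)
      (cong (λ b → if b then lookup ys x else lookup xs x) (dec-false (P? x) ¬px))

x∈p─q⇒x∉q : ∀ {m} {p q : Subset m} {x} → x ∈ p ─ q → x ∉ q
x∈p─q⇒x∉q {p = _ ∷ _} {true ∷ _}  {Fin.zero} ()
x∈p─q⇒x∉q {p = _ ∷ _} {false ∷ _} {Fin.zero} _ ()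
x∈p─q⇒x∉q {p = _ ∷ p} {_ ∷ q} {Fin.suc x} (Vec.there x∈) (Vec.there x∈q) = x∈p─q⇒x∉q {p = p} x∈ x∈q

module _ {n : ℕ} where

  -- ⌊_⌋ rather than does, so that colorClass c i is definitionally subset (λ v → colour c v ≟ i).
  subset : {P : Fin n → Set} → Decidable P → Subset n
  subset P? = tabulate λ x → ⌊ P? x ⌋

  ∈-subset⁻ : ∀ {P : Fin n → Set} (P? : Decidable P) {x} → x ∈ subset P? → P x
  ∈-subset⁻ P? {x} x∈ with P? x | trans (sym (lookup∘tabulate _ x)) ([]=⇒lookup x∈)
  ... | yes px | _ = px
  ... | no _   | ()

  ∈-subset⁺ : ∀ {P : Fin n → Set} (P? : Decidable P) {x} → P x → x ∈ subset P?
  ∈-subset⁺ P? {x} px = lookup⇒[]= x _ (trans (lookup∘tabulate _ x) (⌊⌋≡true (P? x)))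
    where
      ⌊⌋≡true : (d : Dec _) → ⌊ d ⌋ ≡ true
      ⌊⌋≡true (yes _) = refl
      ⌊⌋≡true (no ¬px) = contradiction px ¬px

  x∈p-y⇒x≢y : ∀ {p : Subset n} {x y} → x ∈ p - y → x ≢ y
  x∈p-y⇒x≢y {y = y} x∈ refl = x∈p─q⇒x∉q x∈ (x∈⁅x⁆ y)

  ⊆-─-⁅⁆ : ∀ {e U : Subset n} {v} → e ⊆ U → v ∉ e → e ⊆ U - v
  ⊆-─-⁅⁆ e⊆U v∉e x∈e = x∈p∧x≢y⇒x∈p-y (e⊆U x∈e) (λ { refl → v∉e x∈e })

  ∁-─-⊆ : ∀ {U M : Subset n} → ∁ (U ─ M) ⊆ ∁ U ∪ M
  ∁-─-⊆ {U} {M} {x} x∈ with x ∈? M | x ∈? U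
  ... | yes x∈M | _      = x∈p∪q⁺ (inj₂ x∈M)
  ... | no _    | no x∉U = x∈p∪q⁺ (inj₁ (x∉p⇒x∈∁p x∉U))
  ... | no x∉M  | yes x∈U = contradiction (x∈p∧x∉q⇒x∈p─q x∈U x∉M) (x∈∁p⇒x∉p x∈)

  _⊏_ : Subset n → Subset n → Set
  _⊏_ = _<_ on ∣_∣

  ⊏-wellFounded : WellFounded _⊏_
  ⊏-wellFounded = On.wellFounded ∣_∣ <-wellFounded

module _ {n : ℕ} (H : Hypergraph n) where

  independent? : Decidable (Independent H)
  independent? S = map′ (λ none e e∈ → All.lookup none e∈) (λ ind → All.tabulate λ {e} e∈ → ind e e∈)
                        (All.all? (λ e → ¬? (e ⊆? S)) (edges H))

  independent-⊆ : ∀ {S T} → S ⊆ T → Independent H T → Independent H S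
  independent-⊆ S⊆T T-ind e e∈ e⊆S = T-ind e e∈ (λ x∈ → S⊆T (e⊆S x∈))

  module GreedyExtension (U : Subset n) where

    extend : List (Fin n) → Subset n → Subset n
    extend []       S = S
    extend (v ∷ vs) S with v ∈? U ×-dec independent? (S ∪ ⁅ v ⁆)
    ... | yes _ = extend vs (S ∪ ⁅ v ⁆)
    ... | no _  = extend vs S

    extend-spec : ∀ vs S → S ⊆ U → Independent H S →
      S ⊆ extend vs S × extend vs S ⊆ U × Independent H (extend vs S) ×
      (∀ v → v ∈ₗ vs → v ∈ U → v ∉ extend vs S → ¬ Independent H (extend vs S ∪ ⁅ v ⁆))
    extend-spec [] S S⊆U S-ind = ⊆-refl , S⊆U , S-ind , λ _ ()
    extend-spec (v ∷ vs) S S⊆U S-ind with v ∈? U ×-dec independent? (S ∪ ⁅ v ⁆)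
    ... | yes (v∈U , Sv-ind) =
      let (S⊆M , M⊆U , M-ind , maximal) = extend-spec vs (S ∪ ⁅ v ⁆) Sv⊆U Sv-ind in
      (λ x∈ → S⊆M (x∈p∪q⁺ (inj₁ x∈))) , M⊆U , M-ind , λ where
        w (here refl) _ w∉M → contradiction (S⊆M (x∈p∪q⁺ (inj₂ (x∈⁅x⁆ w)))) w∉M
        w (there w∈vs)      → maximal w w∈vs
      where
        Sv⊆U : S ∪ ⁅ v ⁆ ⊆ U
        Sv⊆U x∈ = [ S⊆U , (λ x∈v → subst (_∈ U) (sym (x∈⁅y⁆⇒x≡y v x∈v)) v∈U) ]
                    (x∈p∪q⁻ S ⁅ v ⁆ x∈)
    ... | no ¬add =
      let (S⊆M , M⊆U , M-ind , maximal) = extend-spec vs S S⊆U S-ind in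
      S⊆M , M⊆U , M-ind , λ where
        w (here refl) w∈U _ Mw-ind → ¬add (w∈U , independent-⊆ (∪-monoˡ S⊆M) Mw-ind)
        w (there w∈vs)             → maximal w w∈vs
      where
        ∪-monoˡ : ∀ {A B C} → A ⊆ B → A ∪ C ⊆ B ∪ C
        ∪-monoˡ {A} {B} {C} A⊆B x∈ = [ (λ x∈A → x∈p∪q⁺ (inj₁ (A⊆B x∈A))) , (λ x∈C → x∈p∪q⁺ (inj₂ x∈C)) ]
                                       (x∈p∪q⁻ A C x∈)

  maxIndep-extend : ∀ {U S} → S ⊆ U → Independent H S → ∃ λ M → S ⊆ M × MaxIndepIn H U M
  maxIndep-extend {U} {S} S⊆U S-ind =
    let (S⊆M , M⊆U , M-ind , maximal) = GreedyExtension.extend-spec U (allFin n) S S⊆U S-ind in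
    _ , S⊆M , M⊆U , M-ind , λ v → maximal v (∈-allFin v)

  ∈-remainder⁺ : ∀ {k U x} {Ss : Vec (Subset n) k} → x ∈ U → VAll.All (x ∉_) Ss → x ∈ remainder H U Ss
  ∈-remainder⁺ x∈U VAll.[]             = x∈U
  ∈-remainder⁺ x∈U (x∉S VAll.∷ x∉Ss) = ∈-remainder⁺ (x∈p∧x∉q⇒x∈p─q x∈U x∉S) x∉Ss

  partner : Fin n → Subset n → Fin n
  partner v e with any? (λ w → (w ∈? e) ×-dec ¬? (w ≟ᶠ v))
  ... | yes (w , _) = w
  ... | no _        = v

  partner-spec : ∀ {q} {c : Coloring H q} → Proper H c →
                 ∀ v {e} → e ∈ₗ edges H → partner v e ∈ e × partner v e ≢ v
  partner-spec {c = c} c-proper v {e} e∈ with any? (λ w → (w ∈? e) ×-dec ¬? (w ≟ᶠ v))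
  ... | yes (_ , spec) = spec
  ... | no none = ⊥-elim (c-proper e e∈ λ x y x∈ y∈ → cong (lookup c) (trans (≡v x∈) (sym (≡v y∈))))
    where
      ≡v : ∀ {x} → x ∈ e → x ≡ v
      ≡v {x} x∈ = decidable-stable (x ≟ᶠ v) λ x≢v → none (x , x∈ , x≢v)

  edgesAt : Subset n → Fin n → List (Subset n)
  edgesAt U v = filter (λ e → (e ⊆? U) ×-dec (v ∈? e)) (edges H)

  ∈-edgesAt⁺ : ∀ {U v e} → e ∈ₗ edges H → e ⊆ U → v ∈ e → e ∈ₗ edgesAt U v
  ∈-edgesAt⁺ {U} {v} e∈ e⊆U v∈e = ∈-filter⁺ (λ e → (e ⊆? U) ×-dec (v ∈? e)) e∈ (e⊆U , v∈e)

module _ {n : ℕ} (H : Hypergraph n) {q : ℕ} where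

  colour : Coloring H q → Fin n → ℕ
  colour c x = toℕ (lookup c x)

  ProperOn : Subset n → Coloring H q → Set
  ProperOn U c = ∀ e → e ∈ₗ edges H → e ⊆ U → ¬ Monochromatic H c e

  monochromatic-agree : ∀ {c d : Coloring H q} {e} →
                        Agree (_∈ e) c d → Monochromatic H c e → Monochromatic H d e
  monochromatic-agree c≈d mono x y x∈ y∈ = trans (sym (c≈d x x∈)) (trans (mono x y x∈ y∈) (c≈d y y∈))

  properOn-⊆ : ∀ {A B} {c : Coloring H q} → A ⊆ B → ProperOn B c → ProperOn A c
  properOn-⊆ A⊆B B-proper e e∈ e⊆A = B-proper e e∈ (λ x∈ → A⊆B (e⊆A x∈))

  properOn-agree : ∀ {U} {c d : Coloring H q} → Agree (_∈ U) c d → ProperOn U c → ProperOn U d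
  properOn-agree {c = c} {d} c≈d c-proper e e∈ e⊆U mono =
    c-proper e e∈ e⊆U (monochromatic-agree {d} {c} (λ x x∈ → sym (c≈d x (e⊆U x∈))) mono)

  properOn-∪ : ∀ {A B} {c : Coloring H q} → ProperOn A c → ProperOn B c →
               (∀ {x y} → x ∈ A → y ∈ B → lookup c x ≢ lookup c y) → ProperOn (A ∪ B) c
  properOn-∪ {A} {B} A-proper B-proper separated e e∈ e⊆A∪B mono
    with any? (λ z → (z ∈? e) ×-dec ¬? (z ∈? A))
  ... | no none = A-proper e e∈ (λ {x} x∈ → decidable-stable (x ∈? A) λ x∉A → none (x , x∈ , x∉A)) mono
  ... | yes (z , z∈e , z∉A) = B-proper e e∈ e⊆B mono
    where
      z∈B : z ∈ B
      z∈B = [ (λ z∈A → contradiction z∈A z∉A) , (λ z∈B → z∈B) ] (x∈p∪q⁻ A B (e⊆A∪B z∈e))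
      e⊆B : e ⊆ B
      e⊆B {x} x∈e = [ (λ x∈A → contradiction (mono x z x∈e z∈e) (separated x∈A z∈B)) , (λ x∈B → x∈B) ]
                      (x∈p∪q⁻ A B (e⊆A∪B x∈e))

  proper⇒properOn : ∀ {U} {c : Coloring H q} → Proper H c → ProperOn U c
  proper⇒properOn c-proper e e∈ _ = c-proper e e∈

  independent⇒properOn : ∀ {M} {c : Coloring H q} → Independent H M → ProperOn M c
  independent⇒properOn M-ind e e∈ e⊆M _ = M-ind e e∈ e⊆M

  properOn-empty : ∀ {U} {c : Coloring H q} {q₀} {c₀ : Coloring H q₀} →
                   Proper H c₀ → ¬ Nonempty U → ProperOn U c
  properOn-empty c₀-proper empty e e∈ e⊆U _ = c₀-proper e e∈ λ x _ x∈ _ → ⊥-elim (empty (x , e⊆U x∈))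

  proper-by-threshold : ∀ {U} {c : Coloring H q} t → ProperOn U c → ProperOn (∁ U) c →
                        (∀ x → x ∈ U → t ≤ colour c x) → (∀ x → x ∉ U → colour c x < t) → Proper H c
  proper-by-threshold {U} {c} t U-proper ∁U-proper high low e e∈ =
    properOn-∪ {c = c} U-proper ∁U-proper separated e e∈ λ {x} _ → U∪∁U x
    where
      U∪∁U : ∀ x → x ∈ U ∪ ∁ U
      U∪∁U x with x ∈? U
      ... | yes x∈U = x∈p∪q⁺ (inj₁ x∈U)
      ... | no x∉U  = x∈p∪q⁺ (inj₂ (x∉p⇒x∈∁p x∉U))
      separated : ∀ {x y} → x ∈ U → y ∈ ∁ U → lookup c x ≢ lookup c y
      separated {x} {y} x∈U y∈∁U cx≡cy =
        <⇒≱ (low y (x∈∁p⇒x∉p y∈∁U)) (subst (t ≤_) (cong toℕ cx≡cy) (high x x∈U))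

  -- Walks in Γ_q(H)

  Move : (Coloring H q → Set) → Coloring H q → Coloring H q → Set
  Move G c d = G c × G d × Adjacent H c d

  Walk : (Coloring H q → Set) → Coloring H q → Coloring H q → Set
  Walk G = Star (Move G)

  walk-map : ∀ {G G′ : Coloring H q → Set} → (∀ {c} → G c → G′ c) →
             ∀ {c d} → Walk G c d → Walk G′ c d
  walk-map f = Star.map λ (gc , gd , adj) → f gc , f gd , adj

  walk-reverse : ∀ {G c d} → Walk G c d → Walk G d c
  walk-reverse = reverse λ (gc , gd , v , cv≢dv , c≈d) →
    gd , gc , v , (λ eq → cv≢dv (sym eq)) , (λ x x≢v → sym (c≈d x x≢v))

  walk⇒path : ∀ {c d} → Walk (Proper H) c d → Path H c d
  walk⇒path ε                          = stop
  walk⇒path ((_ , d-proper , adj) ◅ w) = step d-proper adj (walk⇒path w)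

  single-vertex-walk : ∀ {G c d} v → G c → G d → Agree (_≢ v) c d → Walk G c d
  single-vertex-walk {G} {c} {d} v gc gd c≈d with lookup c v ≟ᶠ lookup d v
  ... | no cv≢dv  = (gc , gd , v , cv≢dv , c≈d) ◅ ε
  ... | yes cv≡dv = subst (Walk G c) (agree-everywhere⇒≡ same) ε
    where
      same : ∀ x → lookup c x ≡ lookup d x
      same x with x ≟ᶠ v
      ... | yes refl = cv≡dv
      ... | no x≢v   = c≈d x x≢v

  splice : ℕ → Coloring H q → Coloring H q → Coloring H q
  splice i = overwrite (λ x → toℕ x <? i)

  module _ (i : ℕ) (c d : Coloring H q) {x : Fin n} where

    lookup-splice-< : toℕ x < i → lookup (splice i c d) x ≡ lookup d x
    lookup-splice-< = lookup-overwrite⁺ (λ z → toℕ z <? i) c d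

    lookup-splice-≮ : ¬ toℕ x < i → lookup (splice i c d) x ≡ lookup c x
    lookup-splice-≮ = lookup-overwrite⁻ (λ z → toℕ z <? i) c d

  interpolation-walk : ∀ {G c d} → (∀ i → i ≤ n → G (splice i c d)) → Walk G c d
  interpolation-walk {G} {c} {d} G-splice = subst₂ (Walk G) splice-0 splice-n (walk-to n ≤-refl)
    where
      splice-0 : splice 0 c d ≡ c
      splice-0 = agree-everywhere⇒≡ λ x → lookup-splice-≮ 0 c d λ ()
      splice-n : splice n c d ≡ d
      splice-n = agree-everywhere⇒≡ λ x → lookup-splice-< n c d (toℕ<n x)
      walk-to : ∀ i → i ≤ n → Walk G (splice 0 c d) (splice i c d)
      walk-to zero    _   = ε
      walk-to (suc i) i<n = walk-to i (<⇒≤ i<n) ◅◅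
        single-vertex-walk (fromℕ< i<n) (G-splice i (<⇒≤ i<n)) (G-splice (suc i) i<n) unchanged
        where
          unchanged : Agree (_≢ fromℕ< i<n) (splice i c d) (splice (suc i) c d)
          unchanged x x≢i with toℕ x <? i
          ... | yes x<i = trans (lookup-splice-< i c d x<i) (sym (lookup-splice-< (suc i) c d (m<n⇒m<1+n x<i)))
          ... | no x≮i  = trans (lookup-splice-≮ i c d x≮i) (sym (lookup-splice-≮ (suc i) c d x≮1+i))
            where
              x≮1+i : ¬ toℕ x < suc i
              x≮1+i x<1+i = [ x≮i , (λ x≡i → x≢i (toℕ-injective (trans x≡i (sym (toℕ-fromℕ< i<n))))) ]
                              (m≤n⇒m<n∨m≡n (≤-pred x<1+i))

  recolour : Coloring H q → Subset n → Fin q → Coloring H q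
  recolour c M y = overwrite (_∈? M) c (replicate n y)

  lookup-recolour-∈ : ∀ {c M y x} → x ∈ M → lookup (recolour c M y) x ≡ y
  lookup-recolour-∈ {c} {M} {y} {x} x∈M =
    trans (lookup-overwrite⁺ (_∈? M) c (replicate n y) x∈M) (lookup-replicate x y)

  recolour-agree : ∀ {c M y} → Agree (_∉ M) (recolour c M y) c
  recolour-agree {c} {M} {y} x = lookup-overwrite⁻ (_∈? M) c (replicate n y)

  colour-recolour-∈ : ∀ {c M y x} → x ∈ M → colour (recolour c M y) x ≡ toℕ y
  colour-recolour-∈ {c} x∈M = cong toℕ (lookup-recolour-∈ {c} x∈M)

  colour-recolour-∉ : ∀ {c M y x} → x ∉ M → colour (recolour c M y) x ≡ colour c x
  colour-recolour-∉ {c} {M} {y} {x} x∉M = cong toℕ (recolour-agree {c} {M} {y} x x∉M)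

  recolour-agree-outside : ∀ {U M c d y} → M ⊆ U → Agree (_∉ U) c d →
                           Agree (_∉ U ─ M) (recolour c M y) (recolour d M y)
  recolour-agree-outside {U} {M} {c} {d} {y} M⊆U c≈d x x∉ with x ∈? M
  ... | yes x∈M = trans (lookup-recolour-∈ {c} x∈M) (sym (lookup-recolour-∈ {d} x∈M))
  ... | no x∉M  = trans (recolour-agree {c} {M} {y} x x∉M)
                    (trans (c≈d x λ x∈U → x∉ (x∈p∧x∉q⇒x∈p─q x∈U x∉M))
                           (sym (recolour-agree {d} {M} {y} x x∉M)))

  PartialRecolouring : Coloring H q → Subset n → Fin q → Coloring H q → Set
  PartialRecolouring c M y d = ∀ x → lookup d x ≡ lookup c x ⊎ (x ∈ M × lookup d x ≡ y)

  recolour-partial : ∀ {c M y} → PartialRecolouring c M y (recolour c M y)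
  recolour-partial {c} {M} {y} x with x ∈? M
  ... | yes x∈M = inj₂ (x∈M , lookup-recolour-∈ {c} x∈M)
  ... | no x∉M  = inj₁ (recolour-agree {c} {M} {y} x x∉M)

  splice-partial : ∀ {c M y d} i → PartialRecolouring c M y d → PartialRecolouring c M y (splice i c d)
  splice-partial {c} {M} {y} {d} i d-partial x with toℕ x <? i
  ... | no x≮i  = inj₁ (lookup-splice-≮ i c d x≮i)
  ... | yes x<i = Sum.map (trans d≡) (Product.map₂ (trans d≡)) (d-partial x)
    where d≡ = lookup-splice-< i c d x<i

  -- A monochromatic edge of d either contains a vertex coloured y, and then lies in M (in c the colour y
  -- occurs only inside M), contradicting independence, or it avoids y and was already monochromatic in c.
  partialRecolouring-proper : ∀ {c M y d} → Proper H c → Independent H M →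
                              (∀ x → lookup c x ≡ y → x ∈ M) → PartialRecolouring c M y d → Proper H d
  partialRecolouring-proper {c} {M} {y} {d} c-proper M-ind class d-partial e e∈ mono
    with any? (λ x → (x ∈? e) ×-dec (lookup d x ≟ᶠ y))
  ... | yes (x₀ , x₀∈e , dx₀≡y) = M-ind e e∈ λ {z} z∈e →
    [ (λ dz≡cz → class z (trans (sym dz≡cz) (trans (mono z x₀ z∈e x₀∈e) dx₀≡y))) , proj₁ ] (d-partial z)
  ... | no none = c-proper e e∈ (monochromatic-agree {d} {c} unchanged mono)
    where
      unchanged : Agree (_∈ e) d c
      unchanged z z∈e = [ (λ dz≡cz → dz≡cz) , (λ (_ , dz≡y) → contradiction (z , z∈e , dz≡y) none) ]
                          (d-partial z)

  module _ {c : Coloring H q} {M y} (c-proper : Proper H c) (M-ind : Independent H M)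
           (class : ∀ x → lookup c x ≡ y → x ∈ M) where

    recolour-proper : Proper H (recolour c M y)
    recolour-proper =
      partialRecolouring-proper {c} {M} {y} {recolour c M y} c-proper M-ind class (recolour-partial {c})

    recolour-walk : Walk (Proper H) c (recolour c M y)
    recolour-walk = interpolation-walk λ i _ →
      partialRecolouring-proper {c} {M} {y} {splice i c (recolour c M y)} c-proper M-ind class
        (splice-partial {c} {M} {y} {recolour c M y} i (recolour-partial {c}))

module _ {n : ℕ} (H : Hypergraph n) (β : ℕ) where

  NoCore : Subset n → Set
  NoCore U = ¬ HasCore H β U

  noCore-⊆ : ∀ {A B} → A ⊆ B → NoCore B → NoCore A
  noCore-⊆ A⊆B B-noCore (W , W⊆A , W-ne , W-deg) = B-noCore (W , (λ x∈ → A⊆B (W⊆A x∈)) , W-ne , W-deg)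

  noCore⇒lowDegree : ∀ {U} → NoCore U → Nonempty U → ∃ λ v → v ∈ U × degreeIn H U v < β
  noCore⇒lowDegree {U} U-noCore U-ne with all? (λ v → (v ∈? U) →-dec (β ≤? degreeIn H U v))
  ... | yes high = ⊥-elim (U-noCore (U , ⊆-refl , U-ne , high))
  ... | no ¬high =
    let (v , ¬v-high) = ¬∀⟶∃¬ n _ (λ v → (v ∈? U) →-dec (β ≤? degreeIn H U v)) ¬high in
    v , decidable-stable (v ∈? U) (λ v∉U → ¬v-high λ v∈U → contradiction v∈U v∉U) ,
    ≰⇒> (λ β≤ → ¬v-high λ _ → β≤)

  ColorableFrom : Subset n → ℕ → Set
  ColorableFrom U k = (Ss : Vec (Subset n) k) → MaxIndepSeqFrom H U Ss → NoCore (remainder H U Ss)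

  colorableFrom-zero : ∀ {U} → ColorableFrom U 0 → NoCore U
  colorableFrom-zero col = col [] _

  colorableFrom-step : ∀ {U M k} → ColorableFrom U (suc k) → MaxIndepIn H U M → ColorableFrom (U ─ M) k
  colorableFrom-step col M-max Ss Ss-seq = col (_ ∷ Ss) (M-max , Ss-seq)

  module _ {q : ℕ} where

    highPart : Subset n → ℕ → Coloring H q → Subset n
    highPart U t c = subset (λ x → (x ∈? U) ×-dec (t ≤? colour H c x))

    highPart⊆highPart : ∀ {U t c U′ t′ c′} →
                 (∀ x → x ∈ U → t ≤ colour H c x → x ∈ U′ × t′ ≤ colour H c′ x) →
                 highPart U t c ⊆ highPart U′ t′ c′
    highPart⊆highPart {U} {t} {c} {U′} {t′} {c′} sub {x} x∈ =
      ∈-subset⁺ (λ z → (z ∈? U′) ×-dec (t′ ≤? colour H c′ z))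
        (Product.uncurry (sub x) (∈-subset⁻ (λ z → (z ∈? U) ×-dec (t ≤? colour H c z)) x∈))

    highPart⊆U : ∀ {U t c} → highPart U t c ⊆ U
    highPart⊆U {U} {t} {c} x∈ = proj₁ (∈-subset⁻ (λ z → (z ∈? U) ×-dec (t ≤? colour H c z)) x∈)

    -- On U, c is a good greedy colouring with k layers shifted up by a; Layered allows one spare top colour.
    record Greedy (U : Subset n) (a k : ℕ) (b c : Coloring H q) : Set where
      field
        proper     : Proper H c
        agrees     : Agree (_∉ U) c b
        inRange    : ∀ x → x ∈ U → InRange a (k + β) (colour H c x)
        highNoCore : NoCore (highPart U (a + k) c)

    record Layered (U : Subset n) (a k : ℕ) (b c : Coloring H q) : Set where
      field
        proper     : Proper H c
        agrees     : Agree (_∉ U) c b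
        below      : ∀ x → x ∉ U → colour H c x < a
        inRange    : ∀ x → x ∈ U → InRange a (k + suc β) (colour H c x)
        highNoCore : NoCore (highPart U (suc (a + k)) c)

    maxIndep⊇colourClass : ∀ {U a} {c : Coloring H q} → Proper H c →
                           ∃ λ M → MaxIndepIn H U M × (∀ x → x ∈ U → colour H c x ≡ a → x ∈ M)
    maxIndep⊇colourClass {U} {a} {c} c-proper =
      let (M , class⊆M , M-max) = maxIndep-extend H class⊆U class-ind
      in M , M-max , λ x x∈U cx≡a → class⊆M (∈-subset⁺ in-class? (x∈U , cx≡a))
      where
        in-class? : Decidable (λ x → x ∈ U × colour H c x ≡ a)
        in-class? x = (x ∈? U) ×-dec (colour H c x ≟ a)
        class⊆U : subset in-class? ⊆ U
        class⊆U x∈ = proj₁ (∈-subset⁻ in-class? x∈)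
        class-ind : Independent H (subset in-class?)
        class-ind e e∈ e⊆class = c-proper e e∈ λ x y x∈ y∈ →
          toℕ-injective (trans (proj₂ (∈-subset⁻ in-class? (e⊆class x∈)))
                               (sym (proj₂ (∈-subset⁻ in-class? (e⊆class y∈)))))

    greedy⇒layered : ∀ {U a k b c} → Greedy U (suc a) k b c → (∀ x → x ∉ U → colour H c x < a) →
                     Layered U a k b c
    greedy⇒layered {a = a} {k} {c = c} G c-low = record
      { proper     = Greedy.proper G
      ; agrees     = Greedy.agrees G
      ; below      = c-low
      ; inRange    = λ x x∈ → subst (λ w → InRange a w (colour H c x)) (sym (+-suc k β))
                                     (inRange-suc (Greedy.inRange G x x∈))
      ; highNoCore = Greedy.highNoCore G
      }

    layered-rebase : ∀ {U a k b b′ c} → Agree (_∉ U) b b′ → Layered U a k b c → Layered U a k b′ c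
    layered-rebase b≈b′ L = record
      { proper     = Layered.proper L
      ; agrees     = λ x x∉ → trans (Layered.agrees L x x∉) (b≈b′ x x∉)
      ; below      = Layered.below L
      ; inRange    = Layered.inRange L
      ; highNoCore = Layered.highNoCore L
      }

    goodGreedy⇒layered : ∀ {α} {χ c : Coloring H q} → GoodGreedy H α β c → Layered ⊤ 0 α χ c
    goodGreedy⇒layered {α} {χ} {c} (c-proper , c<α+β , _ , rest-noCore) = record
      { proper     = c-proper
      ; agrees     = λ x x∉⊤ → contradiction ∈⊤ x∉⊤
      ; below      = λ x x∉⊤ → contradiction ∈⊤ x∉⊤
      ; inRange    = λ x _ → z≤n , subst (colour H c x <_) (sym (+-suc α β)) (m<n⇒m<1+n (c<α+β x))
      ; highNoCore = noCore-⊆ {B = remainder H ⊤ classes} high⊆rest rest-noCore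
      }
      where
        classes : Vec (Subset n) α
        classes = tabulate λ i → colorClass H c (toℕ i)
        high⊆rest : highPart ⊤ (suc α) c ⊆ remainder H ⊤ classes
        high⊆rest {x} x∈ = ∈-remainder⁺ H {Ss = classes} ∈⊤ (tabulate⁺ λ i x∈class →
          <⇒≱ (subst (_< α) (sym (∈-subset⁻ (λ z → colour H c z ≟ toℕ i) x∈class)) (toℕ<n i))
              (<⇒≤ (proj₂ (∈-subset⁻ (λ z → (z ∈? ⊤) ×-dec (suc α ≤? colour H c z)) x∈))))

    module _ {U M : Subset n} {a : ℕ} {y : Fin q} (y≡a : toℕ y ≡ a) (M⊆U : M ⊆ U) where

      recolour-below : ∀ {c} → (∀ x → x ∉ U → colour H c x < a) →
                       ∀ x → x ∉ U ─ M → colour H (recolour H c M y) x < suc a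
      recolour-below {c} c-low x x∉ with x ∈? M
      ... | yes x∈M = s≤s (≤-reflexive (trans (colour-recolour-∈ H {c = c} x∈M) y≡a))
      ... | no x∉M  = m<n⇒m<1+n (subst (_< a) (sym (colour-recolour-∉ H {c = c} x∉M))
                        (c-low x λ x∈U → x∉ (x∈p∧x∉q⇒x∈p─q x∈U x∉M)))

      recolour-properOn-outside : ∀ {c} → Independent H M → ProperOn H (∁ U) c →
                                  (∀ x → x ∉ U → colour H c x < a) → ProperOn H (∁ (U ─ M)) (recolour H c M y)
      recolour-properOn-outside {c} M-ind c-proper c-low =
        properOn-⊆ H {A = ∁ (U ─ M)} {B = ∁ U ∪ M} {c = c′} (∁-─-⊆ {U = U} {M})
          (properOn-∪ H {A = ∁ U} {B = M} {c = c′} outside-proper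
             (independent⇒properOn H {M = M} {c = c′} M-ind) separated)
        where
          c′ = recolour H c M y
          unchanged : ∀ {x} → x ∈ ∁ U → lookup c′ x ≡ lookup c x
          unchanged {x} x∈∁U = recolour-agree H {c = c} {M} {y} x λ x∈M → x∈∁p⇒x∉p x∈∁U (M⊆U x∈M)
          outside-proper : ProperOn H (∁ U) c′
          outside-proper = properOn-agree H {c = c} {d = c′} (λ x x∈∁U → sym (unchanged x∈∁U)) c-proper
          separated : ∀ {x z} → x ∈ ∁ U → z ∈ M → lookup c′ x ≢ lookup c′ z
          separated {x} x∈∁U z∈M cx≡cz = <⇒≢ (c-low x (x∈∁p⇒x∉p x∈∁U))
            (trans (cong toℕ (sym (unchanged x∈∁U)))
                   (trans (cong toℕ cx≡cz) (trans (colour-recolour-∈ H {c = c} z∈M) y≡a)))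

      greedy-add-bottom : ∀ {b k c} → Greedy (U ─ M) (suc a) k (recolour H b M y) c → Greedy U a (suc k) b c
      greedy-add-bottom {b} {k} {c} G = record
        { proper     = Greedy.proper G
        ; agrees     = λ x x∉U → trans (Greedy.agrees G x λ x∈ → x∉U (p─q⊆p U M x∈))
                                       (recolour-agree H {c = b} {M} {y} x λ x∈M → x∉U (M⊆U x∈M))
        ; inRange    = in-range
        ; highNoCore = noCore-⊆ (highPart⊆highPart {c = c} {c′ = c} high) (Greedy.highNoCore G)
        }
        where
          colour-M : ∀ {x} → x ∈ M → colour H c x ≡ a
          colour-M {x} x∈M = trans (cong toℕ (Greedy.agrees G x λ x∈ → x∈p─q⇒x∉q x∈ x∈M))
                                   (trans (colour-recolour-∈ H {c = b} x∈M) y≡a)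
          in-range : ∀ x → x ∈ U → InRange a (suc k + β) (colour H c x)
          in-range x x∈U with x ∈? M
          ... | yes x∈M = subst (InRange a (suc k + β)) (sym (colour-M x∈M)) (≤-refl , m<m+n a z<s)
          ... | no x∉M  = inRange-suc (Greedy.inRange G x (x∈p∧x∉q⇒x∈p─q x∈U x∉M))
          high : ∀ x → x ∈ U → a + suc k ≤ colour H c x → x ∈ U ─ M × suc a + k ≤ colour H c x
          high x x∈U t≤ with x ∈? M
          ... | yes x∈M = contradiction (subst (a + suc k ≤_) (colour-M x∈M) t≤) (<⇒≱ (m<m+n a z<s))
          ... | no x∉M  = x∈p∧x∉q⇒x∈p─q x∈U x∉M , subst (_≤ colour H c x) (+-suc a k) t≤

      recolour-bottom-layer :
        ∀ {k b c} → Independent H M → Layered U a (suc k) b c →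
        (∀ x → x ∈ U → colour H c x ≡ a → x ∈ M) →
        Walk H (Proper H) c (recolour H c M y) ×
        Layered (U ─ M) (suc a) k (recolour H c M y) (recolour H c M y)
      recolour-bottom-layer {k} {b} {c} M-ind L a-class⊆M = recolour-walk H {c = c} c-proper M-ind y-class⊆M , record
        { proper     = recolour-proper H {c = c} c-proper M-ind y-class⊆M
        ; agrees     = λ _ _ → refl
        ; below      = recolour-below {c = c} (Layered.below L)
        ; inRange    = in-range
        ; highNoCore = noCore-⊆ (highPart⊆highPart {c = recolour H c M y} {c′ = c} high) (Layered.highNoCore L)
        }
        where
          c-proper = Layered.proper L
          y-class⊆M : ∀ x → lookup c x ≡ y → x ∈ M
          y-class⊆M x cx≡y with x ∈? U
          ... | yes x∈U = a-class⊆M x x∈U (trans (cong toℕ cx≡y) y≡a)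
          ... | no x∉U  = contradiction (trans (cong toℕ cx≡y) y≡a) (<⇒≢ (Layered.below L x x∉U))
          in-range : ∀ x → x ∈ U ─ M → InRange (suc a) (k + suc β) (colour H (recolour H c M y) x)
          in-range x x∈ = subst (InRange (suc a) (k + suc β)) (sym (colour-recolour-∉ H {c = c} x∉M))
                            (inRange-pred (Layered.inRange L x x∈U)
                               λ a≡cx → x∉M (a-class⊆M x x∈U (sym a≡cx)))
            where
              x∈U : x ∈ U
              x∈U = p─q⊆p U M x∈
              x∉M : x ∉ M
              x∉M = x∈p─q⇒x∉q x∈
          high : ∀ x → x ∈ U ─ M → suc (suc a + k) ≤ colour H (recolour H c M y) x →
                 x ∈ U × suc (a + suc k) ≤ colour H c x
          high x x∈ t≤ = p─q⊆p U M x∈ ,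
            subst₂ _≤_ (cong suc (sym (+-suc a k))) (colour-recolour-∉ H {c = c} (x∈p─q⇒x∉q x∈)) t≤

    module _ {U M : Subset n} {a : ℕ} {y : Fin q} (y≡1+a : toℕ y ≡ suc a) (M⊆U : M ⊆ U) where

      recolour-second-layer :
        ∀ {k b c} → Independent H M → Layered (U ─ M) (suc a) k b c →
        (∀ x → x ∈ U ─ M → suc a < colour H c x) → (∀ x → x ∉ U → colour H c x < a) →
        Walk H (Proper H) c (recolour H c M y) × Layered U a (suc k) c (recolour H c M y) ×
        (∀ x → x ∈ U → colour H (recolour H c M y) x ≢ a)
      recolour-second-layer {k} {b} {c} M-ind L above low = recolour-walk H {c = c} c-proper M-ind y-class⊆M , record
        { proper     = recolour-proper H {c = c} c-proper M-ind y-class⊆M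
        ; agrees     = λ x x∉U → recolour-agree H {c = c} {M} {y} x λ x∈M → x∉U (M⊆U x∈M)
        ; below      = λ x x∉U → subst (_< a) (sym (colour-recolour-∉ H {c = c} λ x∈M → x∉U (M⊆U x∈M)))
                                        (low x x∉U)
        ; inRange    = in-range
        ; highNoCore = noCore-⊆ (highPart⊆highPart {c = recolour H c M y} {c′ = c} high) (Layered.highNoCore L)
        } , avoids-a
        where
          c-proper = Layered.proper L
          y-class⊆M : ∀ x → lookup c x ≡ y → x ∈ M
          y-class⊆M x cx≡y with x ∈? (U ─ M)
          ... | yes x∈ = contradiction (trans (cong toℕ cx≡y) y≡1+a) (≢-sym (<⇒≢ (above x x∈)))
          ... | no x∉  = contradiction (trans (cong toℕ cx≡y) y≡1+a) (<⇒≢ (Layered.below L x x∉))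
          colour-M : ∀ {x} → x ∈ M → colour H (recolour H c M y) x ≡ suc a
          colour-M x∈M = trans (colour-recolour-∈ H {c = c} x∈M) y≡1+a
          in-range : ∀ x → x ∈ U → InRange a (suc k + suc β) (colour H (recolour H c M y) x)
          in-range x x∈U with x ∈? M
          ... | yes x∈M = subst (InRange a (suc k + suc β)) (sym (colour-M x∈M))
                            (inRange-suc (≤-refl , m<m+n (suc a) (subst (0 <_) (sym (+-suc k β)) z<s)))
          ... | no x∉M  = subst (InRange a (suc k + suc β)) (sym (colour-recolour-∉ H {c = c} x∉M))
                            (inRange-suc (Layered.inRange L x (x∈p∧x∉q⇒x∈p─q x∈U x∉M)))
          high : ∀ x → x ∈ U → suc (a + suc k) ≤ colour H (recolour H c M y) x →
                 x ∈ U ─ M × suc (suc a + k) ≤ colour H c x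
          high x x∈U t≤ with x ∈? M
          ... | yes x∈M = contradiction (≤-pred (subst (suc (a + suc k) ≤_) (colour-M x∈M) t≤)) (<⇒≱ (m<m+n a z<s))
          ... | no x∉M  = x∈p∧x∉q⇒x∈p─q x∈U x∉M ,
                          subst₂ _≤_ (cong suc (+-suc a k)) (colour-recolour-∉ H {c = c} x∉M) t≤
          avoids-a : ∀ x → x ∈ U → colour H (recolour H c M y) x ≢ a
          avoids-a x x∈U with x ∈? M
          ... | yes x∈M = λ cx≡a → <⇒≢ (n<1+n a) (trans (sym cx≡a) (colour-M x∈M))
          ... | no x∉M  = λ cx≡a → <⇒≢ (<-trans (n<1+n a) (above x (x∈p∧x∉q⇒x∈p─q x∈U x∉M)))
                                        (sym (trans (sym (colour-recolour-∉ H {c = c} x∉M)) cx≡a))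

    -- χ₀ only serves to rule out edges with fewer than two vertices.
    module _ {χ₀ : Coloring H q} (χ₀-proper : Proper H χ₀) where

      module Palette (a w : ℕ) (a+w≤q : a + w ≤ q) where

        record Recolouring (U : Subset n) (ψ κ : Coloring H q) : Set where
          field
            properOn  : ProperOn H U κ
            agrees    : Agree (_∉ U) κ ψ
            inPalette : ∀ x → x ∈ U → InRange a w (colour H κ x)
        open Recolouring public

        freeColour : (xs : List ℕ) → length xs < w →
                     ∃ λ (y : Fin q) → InRange a w (toℕ y) × toℕ y ∉ₗ xs
        freeColour xs len<w =
          let (m , m-range , m∉xs) = fresh-in-range w a xs len<w
              m<q = <-≤-trans (proj₂ m-range) a+w≤q
              m≡y = sym (toℕ-fromℕ< m<q)
          in fromℕ< m<q , subst (InRange a w) m≡y m-range , subst (_∉ₗ xs) m≡y m∉xs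

        blocked : Coloring H q → Subset n → Fin n → List ℕ
        blocked ρ U v = map (λ e → colour H ρ (partner H v e)) (edgesAt H U v)

        length-blocked : ∀ ρ U v → length (blocked ρ U v) ≡ degreeIn H U v
        length-blocked ρ U v = length-map _ (edgesAt H U v)

        -- An edge through v becomes monochromatic only if y is the colour of v's partner in that edge.
        properOn-update : ∀ {U v ρ y} → ProperOn H (U - v) ρ → toℕ y ∉ₗ blocked ρ U v →
                          ProperOn H U (ρ [ v ]≔ y)
        properOn-update {U} {v} {ρ} {y} ρ-proper y-free e e∈ e⊆U mono with v ∈? e
        ... | no v∉e = ρ-proper e e∈ (⊆-─-⁅⁆ e⊆U v∉e) (monochromatic-agree H {c = ρ [ v ]≔ y} {d = ρ}
                         (λ x x∈ → lookup∘update′ (λ { refl → v∉e x∈ }) ρ y) mono)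
        ... | yes v∈e = y-free (subst (_∈ₗ blocked ρ U v) (sym (cong toℕ y≡ρp))
                          (∈-map⁺ (λ e → colour H ρ (partner H v e)) (∈-edgesAt⁺ H e∈ e⊆U v∈e)))
          where
            p-spec = partner-spec H {c = χ₀} χ₀-proper v e∈
            y≡ρp : y ≡ lookup ρ (partner H v e)
            y≡ρp = trans (sym (lookup∘update v ρ y))
                     (trans (mono v _ v∈e (proj₁ p-spec)) (lookup∘update′ (proj₂ p-spec) ρ y))

        recolouring-update : ∀ {U v ψ ρ y} → v ∈ U → Recolouring (U - v) ψ ρ →
                             InRange a w (toℕ y) → toℕ y ∉ₗ blocked ρ U v → Recolouring U ψ (ρ [ v ]≔ y)
        recolouring-update {U} {v} {ψ} {ρ} {y} v∈U R y-range y-free = record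
          { properOn  = properOn-update {U} {v} {ρ} {y} (properOn R) y-free
          ; agrees    = λ x x∉U → trans (lookup∘update′ (λ { refl → x∉U v∈U }) ρ y)
                                        (agrees R x λ x∈ → x∉U (p─q⊆p U ⁅ v ⁆ x∈))
          ; inPalette = in-palette
          }
          where
            in-palette : ∀ x → x ∈ U → InRange a w (colour H (ρ [ v ]≔ y) x)
            in-palette x x∈U with x ≟ᶠ v
            ... | yes refl = subst (InRange a w ∘ toℕ) (sym (lookup∘update x ρ y)) y-range
            ... | no x≢v   = subst (InRange a w ∘ toℕ) (sym (lookup∘update′ x≢v ρ y))
                                   (inPalette R x (x∈p∧x≢y⇒x∈p-y x∈U x≢v))

        recolouring-restrict : ∀ {U v ψ κ} → Recolouring U ψ κ →
                               Recolouring (U - v) ψ (κ [ v ]≔ lookup ψ v)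
        recolouring-restrict {U} {v} {ψ} {κ} R = record
          { properOn  = λ e e∈ e⊆U-v mono → properOn R e e∈ (λ x∈ → p─q⊆p U ⁅ v ⁆ (e⊆U-v x∈))
                          (monochromatic-agree H {c = κ [ v ]≔ lookup ψ v} {d = κ}
                             (λ x x∈ → lookup∘update′ (x∈p-y⇒x≢y (e⊆U-v x∈)) κ _) mono)
          ; agrees    = agrees′
          ; inPalette = λ x x∈ → subst (InRange a w ∘ toℕ) (sym (lookup∘update′ (x∈p-y⇒x≢y x∈) κ _))
                                        (inPalette R x (p─q⊆p U ⁅ v ⁆ x∈))
          }
          where
            agrees′ : Agree (_∉ U - v) (κ [ v ]≔ lookup ψ v) ψ
            agrees′ x x∉ with x ≟ᶠ v
            ... | yes refl = lookup∘update x κ _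
            ... | no x≢v   = trans (lookup∘update′ x≢v κ _)
                                   (agrees R x λ x∈U → x∉ (x∈p∧x≢y⇒x∈p-y x∈U x≢v))

        recolouring-exists : β ≤ w → ∀ {U} → NoCore U → ∀ ψ → ∃ (Recolouring U ψ)
        recolouring-exists β≤w {U} U-noCore ψ = go U (⊏-wellFounded U) U-noCore
          where
            go : ∀ U → Acc _⊏_ U → NoCore U → ∃ (Recolouring U ψ)
            go U (acc smaller) U-noCore with nonempty? U
            ... | no empty = ψ , record
              { properOn  = properOn-empty H {c = ψ} {c₀ = χ₀} χ₀-proper empty
              ; agrees    = λ _ _ → refl
              ; inPalette = λ x x∈ → contradiction (x , x∈) empty
              }
            ... | yes U-ne =
              let (v , v∈U , low) = noCore⇒lowDegree U-noCore U-ne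
                  (ρ , R) = go (U - v) (smaller (x∈p⇒∣p-x∣<∣p∣ v∈U))
                              (noCore-⊆ (p─q⊆p U ⁅ v ⁆) U-noCore)
                  (y , y-range , y-free) = freeColour (blocked ρ U v)
                    (subst (_< w) (sym (length-blocked ρ U v)) (<-≤-trans low β≤w))
              in ρ [ v ]≔ y , recolouring-update v∈U R y-range y-free

        recolouring-proper : ∀ {U ψ κ} → ProperOn H (∁ U) ψ → (∀ x → x ∉ U → colour H ψ x < a) →
                             Recolouring U ψ κ → Proper H κ
        recolouring-proper {U} {ψ} {κ} ψ-proper ψ-low R =
          proper-by-threshold H {c = κ} a (properOn R)
            (properOn-agree H {c = ψ} {d = κ} (λ x x∈∁U → sym (agrees R x (x∈∁p⇒x∉p x∈∁U))) ψ-proper)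
            (λ x x∈U → proj₁ (inPalette R x x∈U))
            (λ x x∉U → subst (_< a) (sym (cong toℕ (agrees R x x∉U))) (ψ-low x x∉U))

        blocked-update : ∀ {U v u μ μ₁ m} → Agree (_≢ u) μ μ₁ → m ∈ₗ blocked μ₁ U v →
                         m ≡ colour H μ₁ u ⊎ m ∈ₗ blocked μ U v
        blocked-update {U} {v} {u} {μ} {μ₁} μ≈μ₁ m∈
          with ∈-map⁻ (λ e → colour H μ₁ (partner H v e)) m∈
        ... | e , e∈ , refl with partner H v e ≟ᶠ u
        ...   | yes p≡u = inj₁ (cong (colour H μ₁) p≡u)
        ...   | no p≢u  = inj₂ (subst (_∈ₗ blocked μ U v) (cong toℕ (μ≈μ₁ _ p≢u))
                                  (∈-map⁺ (λ e → colour H μ (partner H v e)) e∈))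

        module _ (β<w : β < w) {U : Subset n} {v : Fin n} (v∈U : v ∈ U) (low : degreeIn H U v < β)
                 {ψ : Coloring H q} where

          -- Before the move at u, v is moved to a colour that is free for v both before and after it;
          -- one exists since v has fewer than β edges inside U and the palette has more than β colours.
          lift-move : ∀ {κ μ μ₁ u} → Recolouring (U - v) ψ μ → Recolouring (U - v) ψ μ₁ → Agree (_≢ u) μ μ₁ →
                      Recolouring U ψ κ → Agree (_≢ v) κ μ →
                      ∃ λ κ₁ → Walk H (Recolouring U ψ) κ κ₁ × Recolouring U ψ κ₁ × Agree (_≢ v) κ₁ μ₁
          lift-move {κ} {μ} {μ₁} {u} Rμ Rμ₁ μ≈μ₁ Rκ κ≈μ =
            μ₁ [ v ]≔ y ,
            single-vertex-walk H v Rκ Rκ′ κ≈κ′ ◅◅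
            single-vertex-walk H u Rκ′ Rκ₁ (agree-update {u = u} {v} {y} {μ} {μ₁} μ≈μ₁) ,
            Rκ₁ , λ x x≢v → lookup∘update′ x≢v μ₁ y
            where
              forbidden : List ℕ
              forbidden = colour H μ₁ u ∷ blocked μ U v
              few : length forbidden < w
              few = ≤-trans (s≤s (subst (_< β) (sym (length-blocked μ U v)) low)) β<w
              free = freeColour forbidden few
              y = proj₁ free
              y-range = proj₁ (proj₂ free)
              y-free = proj₂ (proj₂ free)
              Rκ′ : Recolouring U ψ (μ [ v ]≔ y)
              Rκ′ = recolouring-update v∈U Rμ y-range (λ y∈ → y-free (there y∈))
              Rκ₁ : Recolouring U ψ (μ₁ [ v ]≔ y)
              Rκ₁ = recolouring-update v∈U Rμ₁ y-range λ y∈ →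
                      [ (λ y≡ → y-free (here y≡)) , (λ y∈′ → y-free (there y∈′)) ]
                        (blocked-update {U} {v} {u} {μ} {μ₁} μ≈μ₁ y∈)
              κ≈κ′ : Agree (_≢ v) κ (μ [ v ]≔ y)
              κ≈κ′ x x≢v = trans (κ≈μ x x≢v) (sym (lookup∘update′ x≢v μ y))

          lift-walk : ∀ {κ μ μ′} → Walk H (Recolouring (U - v) ψ) μ μ′ → Recolouring U ψ κ → Agree (_≢ v) κ μ →
                      ∃ λ κ′ → Walk H (Recolouring U ψ) κ κ′ × Recolouring U ψ κ′ × Agree (_≢ v) κ′ μ′
          lift-walk ε Rκ κ≈μ = _ , ε , Rκ , κ≈μ
          lift-walk ((Rμ , Rμ₁ , _ , _ , μ≈μ₁) ◅ W) Rκ κ≈μ =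
            let (κ₁ , κ⇝κ₁ , Rκ₁ , κ₁≈μ₁) = lift-move Rμ Rμ₁ μ≈μ₁ Rκ κ≈μ
                (κ′ , κ₁⇝κ′ , Rκ′ , κ′≈μ′) = lift-walk W Rκ₁ κ₁≈μ₁
            in κ′ , κ⇝κ₁ ◅◅ κ₁⇝κ′ , Rκ′ , κ′≈μ′

        recolouring-walk : β < w → ∀ {U ψ κ φ} → NoCore U → Recolouring U ψ κ → Recolouring U ψ φ →
                           Walk H (Recolouring U ψ) κ φ
        recolouring-walk β<w {U} {ψ} U-noCore = go U (⊏-wellFounded U) U-noCore
          where
            go : ∀ U → Acc _⊏_ U → NoCore U → ∀ {κ φ} → Recolouring U ψ κ → Recolouring U ψ φ →
                 Walk H (Recolouring U ψ) κ φ
            go U (acc smaller) U-noCore {κ} {φ} Rκ Rφ with nonempty? U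
            ... | no empty = subst (Walk H (Recolouring U ψ) κ) (agree-everywhere⇒≡ κ≡φ) ε
              where
                κ≡φ : ∀ x → lookup κ x ≡ lookup φ x
                κ≡φ x = trans (agrees Rκ x λ x∈ → empty (x , x∈)) (sym (agrees Rφ x λ x∈ → empty (x , x∈)))
            ... | yes U-ne =
              let (v , v∈U , low) = noCore⇒lowDegree U-noCore U-ne
                  W = go (U - v) (smaller (x∈p⇒∣p-x∣<∣p∣ v∈U)) (noCore-⊆ (p─q⊆p U ⁅ v ⁆) U-noCore)
                         (recolouring-restrict Rκ) (recolouring-restrict Rφ)
                  (κ′ , κ⇝κ′ , Rκ′ , κ′≈φ′) = lift-walk β<w v∈U low W Rκ λ x x≢v → sym (lookup∘update′ x≢v κ _)
              in κ⇝κ′ ◅◅ single-vertex-walk H v Rκ′ Rφ λ x x≢v → trans (κ′≈φ′ x x≢v) (lookup∘update′ x≢v φ _)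

      independent-⊥ : Independent H ⊥
      independent-⊥ e e∈ e⊆⊥ = χ₀-proper e e∈ λ x _ x∈ _ → contradiction (e⊆⊥ x∈) ∉⊥

      greedy-exists : ∀ k a {U} → ColorableFrom U k → ∀ {b} → ProperOn H (∁ U) b →
                      (∀ x → x ∉ U → colour H b x < a) → a + (k + β) ≤ q → ∃ (Greedy U a k b)
      greedy-exists zero a col {b} b-proper b-low bound =
        let (c , R) = recolouring-exists ≤-refl (colorableFrom-zero col) b in
        c , record
          { proper     = recolouring-proper b-proper b-low R
          ; agrees     = agrees R
          ; inRange    = inPalette R
          ; highNoCore = noCore-⊆ (highPart⊆U {t = a + 0} {c}) (colorableFrom-zero col)
          }
        where open Palette a β bound
      greedy-exists (suc k) a {U} col {b} b-proper b-low bound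
        with maxIndep-extend H {U} {⊥} (λ x∈ → contradiction x∈ ∉⊥) independent-⊥
      ... | M , _ , M-max@(M⊆U , M-ind , _) =
        let (c , G) = greedy-exists k (suc a) {U ─ M} (colorableFrom-step {U} {M} col M-max) {recolour H b M y}
                        (recolour-properOn-outside y≡a M⊆U {c = b} M-ind b-proper b-low)
                        (recolour-below y≡a M⊆U {c = b} b-low)
                        (subst (_≤ q) (+-suc a (k + β)) bound)
        in c , greedy-add-bottom y≡a M⊆U G
        where
          a<q : a < q
          a<q = <-≤-trans (m<m+n a z<s) bound
          y : Fin q
          y = fromℕ< a<q
          y≡a : toℕ y ≡ a
          y≡a = toℕ-fromℕ< a<q

      -- Walk to a fresh greedy colouring of U ─ M that avoids the colour suc a, then lift M to suc a.
      vacate-bottom :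
        ∀ {k a U M ψ} →
        (∀ {U′ ψ φ} → ColorableFrom U′ k → Layered U′ (suc a) k ψ ψ → Layered U′ (suc a) k ψ φ →
                      Walk H (Proper H) ψ φ) →
        ColorableFrom (U ─ M) k → suc a + (k + suc β) ≤ q → M ⊆ U → Independent H M →
        Layered (U ─ M) (suc a) k ψ ψ → (∀ x → x ∉ U → colour H ψ x < a) →
        ∃ λ ψ′ → Walk H (Proper H) ψ ψ′ × Layered U a (suc k) ψ ψ′ × (∀ x → x ∈ U → colour H ψ′ x ≢ a)
      vacate-bottom {k} {a} {U} {M} {ψ} walk-k col bound M⊆U M-ind L ψ-low
        with greedy-exists k (suc (suc a)) {U ─ M} col {ψ}
               (proper⇒properOn H {U = ∁ (U ─ M)} {c = ψ} (Layered.proper L))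
               (λ x x∉ → m<n⇒m<1+n (Layered.below L x x∉))
               (subst (_≤ q) (cong suc (trans (cong (a +_) (+-suc k β)) (+-suc a (k + β)))) bound)
      ... | ψ₂ , G₂ =
        let (ψ₂⇝ψ′ , L′ , avoids-a) = recolour-second-layer y≡1+a M⊆U M-ind L₂
                                        (λ x x∈ → proj₁ (Greedy.inRange G₂ x x∈))
                                        (λ x x∉U → subst (_< a) (sym (cong toℕ (ψ₂≈ψ x x∉U))) (ψ-low x x∉U))
        in recolour H ψ₂ M y , walk-k col L L₂ ◅◅ ψ₂⇝ψ′ , layered-rebase ψ₂≈ψ L′ , avoids-a
        where
          1+a<q : suc a < q
          1+a<q = <-≤-trans (m<m+n (suc a) (subst (0 <_) (sym (+-suc k β)) z<s)) bound
          y : Fin q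
          y = fromℕ< 1+a<q
          y≡1+a : toℕ y ≡ suc a
          y≡1+a = toℕ-fromℕ< 1+a<q
          ψ₂≈ψ : Agree (_∉ U) ψ₂ ψ
          ψ₂≈ψ x x∉U = Greedy.agrees G₂ x λ x∈ → x∉U (p─q⊆p U M x∈)
          L₂ : Layered (U ─ M) (suc a) k ψ ψ₂
          L₂ = greedy⇒layered G₂ λ x x∉ →
                 subst (_< suc a) (sym (cong toℕ (Greedy.agrees G₂ x x∉))) (Layered.below L x x∉)

      layered-walk : ∀ k a {U} → ColorableFrom U k → a + (k + suc β) ≤ q →
                     ∀ {ψ φ} → Layered U a k ψ ψ → Layered U a k ψ φ → Walk H (Proper H) ψ φ
      layered-walk zero a {U} col bound {ψ} Lψ Lφ =
        walk-map H (recolouring-proper {U} {ψ} (proper⇒properOn H {U = ∁ U} {c = ψ} (Layered.proper Lψ))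
                                                (Layered.below Lψ))
          (recolouring-walk ≤-refl (colorableFrom-zero col) (recolouring Lψ) (recolouring Lφ))
        where
          open Palette a (suc β) bound
          recolouring : ∀ {c} → Layered U a 0 ψ c → Recolouring U ψ c
          recolouring {c} L = record
            { properOn  = proper⇒properOn H {U = U} {c = c} (Layered.proper L)
            ; agrees    = Layered.agrees L
            ; inPalette = Layered.inRange L
            }
      layered-walk (suc k) a {U} col bound {ψ} {φ} Lψ Lφ
        with maxIndep⊇colourClass {U} {a} {ψ} (Layered.proper Lψ)
           | maxIndep⊇colourClass {U} {a} {φ} (Layered.proper Lφ)
      ... | M , M-max@(M⊆U , M-ind , _) , a-class⊆M | M′ , M′-max@(M′⊆U , M′-ind , _) , a-class⊆M′ =
        let (ψ⇝ψ₁ , Lψ₁) = recolour-bottom-layer y≡a M⊆U M-ind Lψ a-class⊆M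
            ψ₁-low : ∀ x → x ∉ U → colour H (recolour H ψ M y) x < a
            ψ₁-low x x∉U = subst (_< a) (sym (colour-recolour-∉ H {c = ψ} λ x∈M → x∉U (M⊆U x∈M)))
                                 (Layered.below Lψ x x∉U)
            (ψ₂ , ψ₁⇝ψ₂ , Lψ₂ , avoids-a) = vacate-bottom (λ col′ → layered-walk k (suc a) col′ bound′)
                                              (colorableFrom-step {U} {M} col M-max) bound′ M⊆U M-ind Lψ₁ ψ₁-low
            (ψ₂⇝ψ₃ , Lψ₃) = recolour-bottom-layer y≡a M′⊆U M′-ind Lψ₂
                              λ x x∈U c≡a → contradiction c≡a (avoids-a x x∈U)
            (φ⇝φ₁ , Lφ₁) = recolour-bottom-layer y≡a M′⊆U M′-ind Lφ a-class⊆M′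
            φ≈ψ₂ : Agree (_∉ U) φ ψ₂
            φ≈ψ₂ x x∉U = trans (Layered.agrees Lφ x x∉U)
                           (trans (sym (recolour-agree H {c = ψ} {M} {y} x λ x∈M → x∉U (M⊆U x∈M)))
                                  (sym (Layered.agrees Lψ₂ x x∉U)))
        in ψ⇝ψ₁ ◅◅ ψ₁⇝ψ₂ ◅◅ ψ₂⇝ψ₃ ◅◅
           layered-walk k (suc a) (colorableFrom-step {U} {M′} col M′-max) bound′ Lψ₃
             (layered-rebase (recolour-agree-outside H {U = U} {M′} {φ} {ψ₂} {y} M′⊆U φ≈ψ₂) Lφ₁) ◅◅
           walk-reverse H φ⇝φ₁
        where
          bound′ : suc a + (k + suc β) ≤ q
          bound′ = subst (_≤ q) (+-suc a (k + suc β)) bound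
          a<q : a < q
          a<q = <-≤-trans (m<m+n a z<s) bound
          y : Fin q
          y = fromℕ< a<q
          y≡a : toℕ y ≡ a
          y≡a = toℕ-fromℕ< a<q

lemma4 : ∀ {n} (H : Hypergraph n) (α β q : ℕ) → Colorable H α β
       → suc (α + β) ≤ q
       → (χ τ : Coloring H q) → GoodGreedy H α β χ → GoodGreedy H α β τ
       → Path H χ τ
lemma4 H α β q col bound χ τ χ-good τ-good =
  walk⇒path H (layered-walk H β {χ₀ = χ} (proj₁ χ-good) α 0 col (subst (_≤ q) (sym (+-suc α β)) bound)
                 (goodGreedy⇒layered H β {χ = χ} χ-good) (goodGreedy⇒layered H β {χ = χ} τ-good))
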